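{- Let $(K,\le)$ be a weak abstract elementary class and $\mathscr A$ a regular notion of amalgamation on $K$. Let $M_0,M_1,M_2,M_3,M',N\in K$ be such that $M'$ is an $\mathscr A$-amalgam of $M_1,M_2$ over $M_0$ by inclusion, and $N$ is an $\mathscr A$-amalgam of $M_3,M'$ over $M_0$ by inclusion. Then there is $N'\le N$ such that $N'$ is an $\mathscr A$-amalgam of $M_2,M_3$ over $M_0$ by inclusion, and $N$ is an $\mathscr A$-amalgam of $M_1,N'$ over $M_0$ by inclusion.
   Context: Weak AEC: $K$ is a class of structures in a fixed language closed under isomorphism; $\le$ is a partial order on $K$ refining the substructure relation and invariant under isomorphisms; there is $\mathrm{LS}(K)$ with: for $N\in K$, $A\subseteq N$ there is $M\le N$, $A\subseteq M$, $|M|\le|A|+\mathrm{LS}(K)$; unions of $\le$-increasing continuous chains are in $K$ and $\ge$ each member; if $M_1,M_2\le N$ and $M_1\subseteq M_2$ then $M_1\le M_2$. A $K$-embedding $f:M\to N$ is an isomorphism onto $f[M]$ with $f[M]\le N$; $\iota$ denotes inclusions. Notion of amalgamation: for $M_0\le M_1$ and a $K$-embedding $f:M_0\to M_2$, an amalgam is $(N,g_1,g_2)$, $g_i:M_i\to N$ $K$-embeddings with $g_1\restriction M_0=g_2f$. $\mathscr A$ assigns to each $(M_0,M_1,M_2,f)$ a nonempty class $\mathscr A(M_0,M_1,M_2,f)$ of amalgams such that $(M_1,\iota,\mathrm{id})\in\mathscr A(M_0,M_0,M_1,\iota)$, and it is closed under: $(N,g_1,g_2)\mapsto(N',hg_1,hg_2)$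 for $h:N\cong N'$; passing to $(N,g_1h^{ -1},g_2)\in\mathscr A(h[M_0],M',M_2,f(h\restriction M_0)^{ -1})$ for $h:M_1\cong M'$; to $(N,g_1,g_2h^{ -1})\in\mathscr A(M_0,M_1,M',hf)$ for $h:M_2\cong M'$; and to $(N,g_2,g_1)\in\mathscr A(f[M_0],M_2,M_1,f^{ -1})$. For $M_0\le M_1,M_2\le N$, "$N$ is an $\mathscr A$-amalgam of $M_1,M_2$ over $M_0$ by inclusion" means $(N,\iota,\iota)\in\mathscr A(M_0,M_1,M_2,\iota)$. Regular: for $M_0\le M_1$ and $K$-embeddings $f:M_0\to M_2$, $g_i:M_i\to N$ with $g_1\restriction M_0=g_2f$, the following are equivalent: (1) $(N,g_1,g_2)\in\mathscr A(M_0,M_1,M_2,f)$; (2) there are $M_0\le M'\le M_1$ and $g_2[M_2]\le N'\le N$ with $g_1[M']\subseteq N'$, $(N',g_1\restriction M',g_2)\in\mathscr A(M_0,M',M_2,f)$ and $(N,g_1,\iota)\in\mathscr A(M',M_1,N',g_1\restriction M')$; (3) for every $M_0\le M'\le M_1$ there is $N'\le N$ with $(N',g_1\restriction M',g_2)\in\mathscr A(M_0,M',M_2,f)$, and for every such $N'$, $(N,g_1,\iota)\in\mathscr A(M',M_1,N',g_1\restriction M')$. -}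

module Defs where

open import Data.Nat using (ℕ)
open import Data.Vec using (Vec; []; _∷_; map)
open import Data.Vec.Relation.Unary.All using (All; []; _∷_)
import Data.Vec.Relation.Unary.All as All
open import Data.Product using (Σ; Σ-syntax; ∃; ∃-syntax; _×_; _,_; proj₁; proj₂)
open import Data.Sum using (_⊎_; inj₁; inj₂)
open import Relation.Binary.PropositionalEquality
  using (_≡_; refl; sym; trans; cong; cong₂; subst)
open import Induction.WellFounded using (WellFounded)
open import Function using (id; _∘_)
import Data.Empty

record Language : Set₁ where
  field
    FunSym   : Set
    funArity : FunSym → ℕ
    RelSym   : Set
    relArity : RelSym → ℕ

-- The set-theoretic universe is represented by an ambient
-- type U: a structure has as universe a subset  dom ⊆ U  (closed under the
-- interpreted functions).  Interpretations are given as total operations on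
-- U; only their values on dom matter.

module _ (L : Language) (U : Set) where
  open Language L

  Pred : Set₁
  Pred = U → Set

  _⊆_ : Pred → Pred → Set
  S ⊆ T = ∀ {x} → S x → T x

  record Structure : Set₁ where
    field
      dom        : Pred
      fun        : (F : FunSym) → Vec U (funArity F) → U
      fun-closed : ∀ F (xs : Vec U (funArity F)) → All dom xs → dom (fun F xs)
      rel        : (R : RelSym) → Vec U (relArity R) → Set
  open Structure public

  _⊑_ : Structure → Structure → Set
  M ⊑ N = (dom M ⊆ dom N)
        × (∀ F xs → All (dom M) xs → fun M F xs ≡ fun N F xs)
        × (∀ R xs → All (dom M) xs →
             (rel M R xs → rel N R xs) × (rel N R xs → rel M R xs))

  -- equality of structures (same universe, same interpretations on it);
  -- needed because one set-theoretic structure has several representations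
  _≈_ : Structure → Structure → Set
  M ≈ N = (dom N ⊆ dom M) × (M ⊑ N)

  record IsIsoOntoImage (f : U → U) (M N : Structure) : Set where
    field
      mapsInto : ∀ {x} → dom M x → dom N (f x)
      inj      : ∀ {x y} → dom M x → dom M y → f x ≡ f y → x ≡ y
      presFun  : ∀ F xs → All (dom M) xs → f (fun M F xs) ≡ fun N F (map f xs)
      presRel  : ∀ R xs → All (dom M) xs →
                   (rel M R xs → rel N R (map f xs)) × (rel N R (map f xs) → rel M R xs)
  open IsIsoOntoImage public

  IsIso : (U → U) → Structure → Structure → Set
  IsIso h M N = IsIsoOntoImage h M N × (∀ {y} → dom N y → Σ[ x ∈ U ] (dom M x × h x ≡ y))

  Image : (U → U) → Structure → Pred
  Image f M y = Σ[ x ∈ U ] (dom M x × f x ≡ y)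

  private
    preimages : ∀ {n} (f : U → U) (M : Structure) (ys : Vec U n) →
      All (Image f M) ys → Σ[ xs ∈ Vec U n ] (All (dom M) xs × map f xs ≡ ys)
    preimages f M [] [] = [] , [] , refl
    preimages f M (y ∷ ys) ((x , mx , fx≡y) ∷ ps) with preimages f M ys ps
    ... | xs , mxs , eq = x ∷ xs , mx ∷ mxs , cong₂ _∷_ fx≡y eq

  img : (f : U → U) (M N : Structure) → IsIsoOntoImage f M N → Structure
  img f M N e = record
    { dom = Image f M
    ; fun = fun N
    ; fun-closed = λ F ys ps →
        let (xs , mxs , eq) = preimages f M ys ps in
        fun M F xs , fun-closed M F xs mxs ,
        trans (presFun e F xs mxs) (cong (fun N F) eq)
    ; rel = rel N
    }

  restrictIso : ∀ {h M N N'} → M ⊑ N → IsIsoOntoImage h N N' → IsIsoOntoImage h M N'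
  restrictIso {h} {M} {N} {N'} (sub , fs , rs) e = record
    { mapsInto = λ m → mapsInto e (sub m)
    ; inj = λ mx my eq → inj e (sub mx) (sub my) eq
    ; presFun = λ F xs ms →
        trans (cong h (fs F xs ms)) (presFun e F xs (All.map sub ms))
    ; presRel = λ R xs ms →
        (λ r → proj₁ (presRel e R xs (All.map sub ms)) (proj₁ (rs R xs ms) r))
      , (λ r → proj₂ (rs R xs ms) (proj₂ (presRel e R xs (All.map sub ms)) r))
    }

  -- |M| ≤ |A| + κ : an injection from the universe of M into A ⊔ κ
  CardLE : Structure → Pred → Set → Set
  CardLE M A κ = Σ[ c ∈ (U → U ⊎ κ) ]
      ((∀ {x} → dom M x → (Σ[ a ∈ U ] (A a × c x ≡ inj₁ a)) ⊎ (Σ[ k ∈ κ ] (c x ≡ inj₂ k)))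
     × (∀ {x y} → dom M x → dom M y → c x ≡ c y → x ≡ y))

  record WellOrder : Set₁ where
    field
      I         : Set
      _<_       : I → I → Set
      <-irrefl  : ∀ {i} → i < i → Data.Empty.⊥
      <-trans   : ∀ {i j k} → i < j → j < k → i < k
      <-connex  : ∀ i j → (i < j) ⊎ ((i ≡ j) ⊎ (j < i))
      <-wf      : WellFounded _<_
      inhabited : I
  open WellOrder public

  IsLimit : (W : WellOrder) → I W → Set
  IsLimit W i = (Σ[ j ∈ I W ] (_<_ W j i))
              × (∀ j → _<_ W j i → Σ[ k ∈ I W ] (_<_ W j k × _<_ W k i))

  record WeakAEC : Set₁ where
    field
      K    : Structure → Set
      _≤_  : Structure → Structure → Set
      LS   : Set        -- the cardinal LS(K), represented by a type
      K-iso : ∀ {M N h} → K M → IsIso h M N → K N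
      -- ≤ is a partial order on K (antisymmetry is automatic, see ≤⇒⊑)
      ≤-K     : ∀ {M N} → M ≤ N → K M × K N
      ≤-refl  : ∀ {M} → K M → M ≤ M
      ≤-trans : ∀ {M N P} → M ≤ N → N ≤ P → M ≤ P
      ≤⇒⊑ : ∀ {M N} → M ≤ N → M ⊑ N
      ≤-iso : ∀ {M N N' h} (le : M ≤ N) (i : IsIso h N N') →
                img h M N' (restrictIso (≤⇒⊑ le) (proj₁ i)) ≤ N'
      -- representation invariance (set-theoretic extensionality)
      ≤-resp : ∀ {M M' N N'} → M ≈ M' → N ≈ N' → M ≤ N → M' ≤ N'
      LS-ax : ∀ N → K N → (A : Pred) → A ⊆ dom N →
                Σ[ M ∈ Structure ] (M ≤ N × A ⊆ dom M × CardLE M A LS)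
      union-ax : (W : WellOrder) (M : I W → Structure) →
                 (∀ i → K (M i)) →
                 (∀ i j → _<_ W i j → M i ≤ M j) →
                 (∀ i → IsLimit W i → ∀ x →
                     (dom (M i) x → Σ[ j ∈ I W ] (_<_ W j i × dom (M j) x))
                   × (Σ[ j ∈ I W ] (_<_ W j i × dom (M j) x) → dom (M i) x)) →
                 Σ[ N ∈ Structure ]
                   (K N
                   × (∀ x → (dom N x → Σ[ i ∈ I W ] dom (M i) x)
                           × (Σ[ i ∈ I W ] dom (M i) x → dom N x))
                   × (∀ i → M i ≤ N))
      coherence : ∀ {M₁ M₂ N} → M₁ ≤ N → M₂ ≤ N → dom M₁ ⊆ dom M₂ → M₁ ≤ M₂

  module _ (𝐊 : WeakAEC) where
    open WeakAEC 𝐊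

    KEmb : (U → U) → Structure → Structure → Set
    KEmb f M N = Σ[ e ∈ IsIsoOntoImage f M N ] (img f M N e ≤ N)

    _≗_on_ : (U → U) → (U → U) → Structure → Set
    f ≗ g on M = ∀ {x} → dom M x → f x ≡ g x

    IsAmalgam : (M₀ M₁ M₂ : Structure) (f : U → U) (N : Structure) (g₁ g₂ : U → U) → Set
    IsAmalgam M₀ M₁ M₂ f N g₁ g₂ =
      KEmb g₁ M₁ N × KEmb g₂ M₂ N × ((g₁) ≗ (g₂ ∘ f) on M₀)

    -- the class-valued operation 𝒜 is represented by its membership
    -- predicate:  Amalg M₀ M₁ M₂ f N g₁ g₂  ⇔  (N, g₁, g₂) ∈ 𝒜(M₀,M₁,M₂,f)
    record NotionOfAmalgamation : Set₁ where
      field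
        Amalg : (M₀ M₁ M₂ : Structure) (f : U → U) (N : Structure) (g₁ g₂ : U → U) → Set
        members : ∀ {M₀ M₁ M₂ f N g₁ g₂} → Amalg M₀ M₁ M₂ f N g₁ g₂ →
                    (M₀ ≤ M₁) × KEmb f M₀ M₂ × IsAmalgam M₀ M₁ M₂ f N g₁ g₂
        nonempty : ∀ {M₀ M₁ M₂ f} → M₀ ≤ M₁ → KEmb f M₀ M₂ →
                    Σ[ N ∈ Structure ] Σ[ g₁ ∈ (U → U) ] Σ[ g₂ ∈ (U → U) ]
                      Amalg M₀ M₁ M₂ f N g₁ g₂
        trivial : ∀ {M₀ M₁} → M₀ ≤ M₁ → Amalg M₀ M₀ M₁ id M₁ id id
        iso-N : ∀ {M₀ M₁ M₂ f N g₁ g₂ N' h} → Amalg M₀ M₁ M₂ f N g₁ g₂ →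
                  IsIso h N N' → Amalg M₀ M₁ M₂ f N' (h ∘ g₁) (h ∘ g₂)
        iso-M₁ : ∀ {M₀ M₁ M₂ f N g₁ g₂ M' h h⁻¹} (le : M₀ ≤ M₁) →
                   Amalg M₀ M₁ M₂ f N g₁ g₂ → (i : IsIso h M₁ M') →
                   (∀ {x} → dom M₁ x → h⁻¹ (h x) ≡ x) →
                   Amalg (img h M₀ M' (restrictIso (≤⇒⊑ le) (proj₁ i))) M' M₂ (f ∘ h⁻¹)
                         N (g₁ ∘ h⁻¹) g₂
        iso-M₂ : ∀ {M₀ M₁ M₂ f N g₁ g₂ M' h h⁻¹} →
                   Amalg M₀ M₁ M₂ f N g₁ g₂ → IsIso h M₂ M' →
                   (∀ {x} → dom M₂ x → h⁻¹ (h x) ≡ x) →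
                   Amalg M₀ M₁ M' (h ∘ f) N g₁ (g₂ ∘ h⁻¹)
        sym-ax : ∀ {M₀ M₁ M₂ f N g₁ g₂ f⁻¹} →
                   Amalg M₀ M₁ M₂ f N g₁ g₂ → (e : KEmb f M₀ M₂) →
                   (∀ {x} → dom M₀ x → f⁻¹ (f x) ≡ x) →
                   Amalg (img f M₀ M₂ (proj₁ e)) M₂ M₁ f⁻¹ N g₂ g₁
        -- representation invariance (set-theoretic extensionality)
        resp : ∀ {M₀ M₁ M₂ f N g₁ g₂ M₀' M₁' M₂' f' N' g₁' g₂'} →
                 M₀ ≈ M₀' → M₁ ≈ M₁' → M₂ ≈ M₂' → N ≈ N' →
                 f ≗ f' on M₀ → g₁ ≗ g₁' on M₁ → g₂ ≗ g₂' on M₂ →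
                 Amalg M₀ M₁ M₂ f N g₁ g₂ → Amalg M₀' M₁' M₂' f' N' g₁' g₂'

    module _ (𝒜 : NotionOfAmalgamation) where
      open NotionOfAmalgamation 𝒜

      Regular : Set₁
      Regular = ∀ {M₀ M₁ M₂ f N g₁ g₂} → M₀ ≤ M₁ → KEmb f M₀ M₂ →
                 (e₁ : KEmb g₁ M₁ N) (e₂ : KEmb g₂ M₂ N) → g₁ ≗ (g₂ ∘ f) on M₀ →
        let C1 = Amalg M₀ M₁ M₂ f N g₁ g₂
            C2 = Σ[ M' ∈ Structure ] (M₀ ≤ M' × M' ≤ M₁ ×
                   Σ[ N' ∈ Structure ] (img g₂ M₂ N (proj₁ e₂) ≤ N' × N' ≤ N
                     × (∀ {x} → dom M' x → dom N' (g₁ x))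
                     × Amalg M₀ M' M₂ f N' g₁ g₂
                     × Amalg M' M₁ N' g₁ N g₁ id))
            C3 = ∀ M' → M₀ ≤ M' → M' ≤ M₁ →
                   (Σ[ N' ∈ Structure ] (N' ≤ N × Amalg M₀ M' M₂ f N' g₁ g₂))
                 × (∀ N' → N' ≤ N → Amalg M₀ M' M₂ f N' g₁ g₂ →
                      Amalg M' M₁ N' g₁ N g₁ id)
        in (C1 → C2) × (C2 → C1) × (C1 → C3) × (C3 → C1)

      AmalgByIncl : (M₀ M₁ M₂ N : Structure) → Set
      AmalgByIncl M₀ M₁ M₂ N =
        M₀ ≤ M₁ × M₀ ≤ M₂ × M₁ ≤ N × M₂ ≤ N × Amalg M₀ M₁ M₂ id N id id

{-# OPTIONS --safe #-}
-- Regularity (1 ⇒ 3), applied to N as an amalgam of M' and M₃ over M₀ and to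
-- M₀ ≤ M₂ ≤ M', cuts out N' ≤ N amalgamating M₂ and M₃ over M₀ such that N is
-- an amalgam of M' and N' over M₂.  Together with M' as an amalgam of M₂ and
-- M₁ over M₀, this is a decomposition as in (2) exhibiting N as an amalgam of
-- N' and M₁ over M₀; regularity (2 ⇒ 1) and symmetry finish the proof.
module Submission where

open import Defs
open import Data.Product using (Σ-syntax; _×_; _,_; proj₁)
open import Data.Vec using (Vec)
open import Data.Vec.Properties using (map-id)
import Data.Vec.Relation.Unary.All as All
open import Relation.Binary.PropositionalEquality using (refl; sym; trans; cong; subst)
open import Function using (id)

module _ {L : Language} {U : Set} where

  ≈-refl : (M : Structure L U) → _≈_ L U M M
  ≈-refl M = id , id , (λ _ _ _ → refl) , (λ _ _ _ → id , id)

  ≈-sym : (M N : Structure L U) → _≈_ L U M N → _≈_ L U N M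
  ≈-sym M N (N⊆M , M⊆N , funs , rels) =
    M⊆N , N⊆M , (λ F xs ps → sym (funs F xs (All.map N⊆M ps)))
        , (λ R xs ps → let (to , from) = rels R xs (All.map N⊆M ps) in from , to)

  img-id≈ : (M N : Structure L U) (e : IsIsoOntoImage L U id M N) →
            _≈_ L U (img L U id M N e) M
  img-id≈ M N e = (λ {x} m → x , m , refl) , (λ { (_ , m , refl) → m })
    , (λ F xs ps → sym (trans (presFun e F xs (inM ps)) (cong (fun N F) (map-id xs))))
    , (λ R xs ps → let (to , from) = presRel e R xs (inM ps) in
                   (λ r → from (subst (rel N R) (sym (map-id xs)) r))
                 , (λ r → subst (rel N R) (map-id xs) (to r)))
    where
    inM : ∀ {n} {xs : Vec U n} → All.All (Image L U id M) xs → All.All (dom M) xs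
    inM = All.map (λ { (_ , m , refl) → m })

  ≈-img-id : (M N : Structure L U) (e : IsIsoOntoImage L U id M N) →
             _≈_ L U M (img L U id M N e)
  ≈-img-id M N e = ≈-sym (img L U id M N e) M (img-id≈ M N e)

  ⊑⇒isoOntoImage-id : {M N : Structure L U} → _⊑_ L U M N → IsIsoOntoImage L U id M N
  ⊑⇒isoOntoImage-id {N = N} (M⊆N , funs , rels) = record
    { mapsInto = M⊆N
    ; inj      = λ _ _ eq → eq
    ; presFun  = λ F xs ps → trans (funs F xs ps) (cong (fun N F) (sym (map-id xs)))
    ; presRel  = λ R xs ps → let (to , from) = rels R xs ps in
                   (λ r → subst (rel N R) (sym (map-id xs)) (to r))
                 , (λ r → from (subst (rel N R) (map-id xs) r))
    }

module _ {L : Language} {U : Set} (𝐊 : WeakAEC L U) where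
  open WeakAEC 𝐊

  ≤⇒KEmb-id : {M N : Structure L U} → M ≤ N → KEmb L U 𝐊 id M N
  ≤⇒KEmb-id {M} {N} M≤N =
    e , ≤-resp (≈-img-id M N e) (≈-refl N) M≤N
    where e = ⊑⇒isoOntoImage-id (≤⇒⊑ M≤N)

  KEmb-id⇒≤ : {M N : Structure L U} → KEmb L U 𝐊 id M N → M ≤ N
  KEmb-id⇒≤ {M} {N} (e , img≤N) = ≤-resp (img-id≈ M N e) (≈-refl N) img≤N

  module _ (𝒜 : NotionOfAmalgamation L U 𝐊) where
    open NotionOfAmalgamation 𝒜

    Amalg-id⇒AmalgByIncl : {M₀ M₁ M₂ N : Structure L U} →
      Amalg M₀ M₁ M₂ id N id id → AmalgByIncl L U 𝐊 𝒜 M₀ M₁ M₂ N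
    Amalg-id⇒AmalgByIncl a =
      let (M₀≤M₁ , M₀↪M₂ , M₁↪N , M₂↪N , _) = members a in
      M₀≤M₁ , KEmb-id⇒≤ M₀↪M₂ , KEmb-id⇒≤ M₁↪N , KEmb-id⇒≤ M₂↪N , a

    Amalg-id-swap : {M₀ M₁ M₂ N : Structure L U} →
      Amalg M₀ M₁ M₂ id N id id → Amalg M₀ M₂ M₁ id N id id
    Amalg-id-swap {M₀} {M₁} {M₂} {N} a =
      let (_ , M₀↪M₂ , _) = members a in
      resp (img-id≈ M₀ M₂ (proj₁ M₀↪M₂)) (≈-refl M₂) (≈-refl M₁) (≈-refl N)
           (λ _ → refl) (λ _ → refl) (λ _ → refl)
           (sym-ax a M₀↪M₂ (λ _ → refl))

    module _ (regular : Regular L U 𝐊 𝒜) where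

      Amalg-id-split : {M₀ M₁ M₂ N : Structure L U} →
        Amalg M₀ M₁ M₂ id N id id → (M : Structure L U) → M₀ ≤ M → M ≤ M₁ →
        Σ[ N' ∈ Structure L U ]
          (N' ≤ N × Amalg M₀ M M₂ id N' id id × Amalg M M₁ N' id N id id)
      Amalg-id-split a M M₀≤M M≤M₁ =
        let (M₀≤M₁ , M₀↪M₂ , M₁↪N , M₂↪N , _) = members a
            (_ , _ , split , _) = regular M₀≤M₁ M₀↪M₂ M₁↪N M₂↪N (λ _ → refl)
            ((N' , N'≤N , lower) , upper) = split a M M₀≤M M≤M₁
        in N' , N'≤N , lower , upper N' N'≤N lower

      Amalg-id-join : {M₀ M M₁ M₂ N' N : Structure L U} →
        Amalg M₀ M M₂ id N' id id → Amalg M M₁ N' id N id id →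
        Amalg M₀ M₁ M₂ id N id id
      Amalg-id-join {M = M} {M₂ = M₂} {N' = N'} {N = N} lower upper =
        let (M₀≤M , M₀≤M₂ , M≤N' , M₂≤N' , _) = Amalg-id⇒AmalgByIncl lower
            (M≤M₁ , _ , M₁≤N , N'≤N , _) = Amalg-id⇒AmalgByIncl upper
            M₂↪N = ≤⇒KEmb-id (≤-trans M₂≤N' N'≤N)
            (_ , join , _) = regular (≤-trans M₀≤M M≤M₁) (≤⇒KEmb-id M₀≤M₂)
                                     (≤⇒KEmb-id M₁≤N) M₂↪N (λ _ → refl)
        in join (M , M₀≤M , M≤M₁ , N'
                , ≤-resp (≈-img-id M₂ N (proj₁ M₂↪N)) (≈-refl N') M₂≤N'
                , N'≤N , proj₁ (≤⇒⊑ M≤N') , lower , upper)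

lemma3p7 : (L : Language) (U : Set) (𝐊 : WeakAEC L U)
           (𝒜 : NotionOfAmalgamation L U 𝐊) → Regular L U 𝐊 𝒜 →
           (M₀ M₁ M₂ M₃ M' N : Structure L U) →
           AmalgByIncl L U 𝐊 𝒜 M₀ M₁ M₂ M' →
           AmalgByIncl L U 𝐊 𝒜 M₀ M₃ M' N →
           Σ[ N' ∈ Structure L U ]
             (WeakAEC._≤_ 𝐊 N' N
             × AmalgByIncl L U 𝐊 𝒜 M₀ M₂ M₃ N'
             × AmalgByIncl L U 𝐊 𝒜 M₀ M₁ N' N)
lemma3p7 L U 𝐊 𝒜 regular M₀ M₁ M₂ M₃ M' N
         (_ , M₀≤M₂ , _ , M₂≤M' , M'-amalg) (_ , _ , _ , _ , N-amalg) =
  let (N' , N'≤N , N'-amalg , N-over-M₂) =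
        Amalg-id-split 𝐊 𝒜 regular (Amalg-id-swap 𝐊 𝒜 N-amalg)
                       M₂ M₀≤M₂ M₂≤M'
      N-over-M₀ = Amalg-id-join 𝐊 𝒜 regular (Amalg-id-swap 𝐊 𝒜 M'-amalg)
                                            (Amalg-id-swap 𝐊 𝒜 N-over-M₂)
  in N' , N'≤N , Amalg-id⇒AmalgByIncl 𝐊 𝒜 N'-amalg
            , Amalg-id⇒AmalgByIncl 𝐊 𝒜 (Amalg-id-swap 𝐊 𝒜 N-over-M₀)
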